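{- Let $(\lambda,\mu)\in{\sf Kostka}_r^{\mathbb Z}$. Every entry $-1$ of $A^*(\lambda,\mu)$ has an entry $1$ to its left in the same row. Furthermore, all entries strictly between this $-1$ and the rightmost such $1$ (to its left in the same row) are $0$.
   Context: ${\sf Kostka}_r^{\mathbb Z}$ is the set of pairs $(\lambda,\mu)$ of partitions with at most $r$ nonzero parts, $|\lambda|=|\mu|$, $\sum_{i\le t}\lambda_i\ge\sum_{i\le t}\mu_i$ for all $t$. $\lambda'$ is the conjugate partition. Canonical (Ryser) matrix $A(\lambda,\mu)$: let $s=\lambda_1$. Start with the $r\times s$ $\{0,1\}$-matrix whose row $i$ has $\mu_i$ ones in columns $1,\ldots,\mu_i$. For $j=s,s-1,\ldots,1$ in turn: looking only at columns $1,\ldots,j$ of the current matrix, choose $\lambda'_j$ rows, taking rows with the largest number of $1$'s in columns $1,\ldots,j$ and breaking ties by preferring rows further south; in each chosen row, move the rightmost $1$ among columns $1,\ldots,j$ to column $j$. The final matrix is $A(\lambda,\mu)$. Define $A^*(\lambda,\mu)_{i,j}=A(\lambda,\mu)_{i,j}-A(\lambda,\mu)_{i+1,j}$, where $A(\lambda,\mu)_{r+1,j}:=0$. -}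

module Defs where

open import Data.Nat using (ℕ; zero; suc; _+_; _≤_; _<_; _<ᵇ_; _≡ᵇ_; _≤ᵇ_)
open import Data.Bool using (Bool; true; false; if_then_else_; _∧_; _∨_)
open import Data.List using (List; []; _∷_; map; upTo; length; filter)
open import Data.Nat.ListAction using (sum)
open import Data.Vec using (Vec; toList)
open import Data.Maybe using (Maybe; just; nothing)
open import Data.Integer using (ℤ; +_; _-_)
open import Relation.Binary.PropositionalEquality using (_≡_)

-- 1-based indexing into a list, 0 outside the range
at : List ℕ → ℕ → ℕ
at []       _             = 0
at (x ∷ xs) zero          = 0
at (x ∷ xs) (suc zero)    = x
at (x ∷ xs) (suc (suc i)) = at xs (suc i)

-- i-th part (1-based) of a partition given as a vector of r parts; 0 beyond r
part : {r : ℕ} → Vec ℕ r → ℕ → ℕ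
part v i = at (toList v) i

range1 : ℕ → List ℕ
range1 n = map suc (upTo n)

psum : {r : ℕ} → Vec ℕ r → ℕ → ℕ
psum v t = sum (map (part v) (range1 t))

-- a partition with at most r nonzero parts: r weakly decreasing naturals
IsPartition : {r : ℕ} → Vec ℕ r → Set
IsPartition {r} v = ∀ i → 1 ≤ i → i < r → part v (suc i) ≤ part v i

Kostka : (r : ℕ) → Vec ℕ r → Vec ℕ r → Set
Kostka r la mu =
  IsPartition la × IsPartition mu × (psum la r ≡ psum mu r)
  × (∀ t → t ≤ r → psum mu t ≤ psum la t)
  where open import Data.Product using (_×_)

conj : {r : ℕ} → Vec ℕ r → ℕ → ℕ
conj {r} v j = length (filter (λ i → j Data.Nat.≤? part v i) (range1 r))

-- matrices: rows 1..r, columns 1..s, entries indexed by ℕ (0 outside)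
Mat : Set
Mat = ℕ → ℕ → ℕ

initMat : {r : ℕ} → Vec ℕ r → Mat
initMat {r} mu i c = if (1 ≤ᵇ i) ∧ (i ≤ᵇ r) ∧ (1 ≤ᵇ c) ∧ (c ≤ᵇ part mu i) then 1 else 0

cnt : Mat → ℕ → ℕ → ℕ
cnt M i j = sum (map (M i) (range1 j))

beats : Mat → ℕ → ℕ → ℕ → Bool
beats M j k i = (cnt M i j <ᵇ cnt M k j) ∨ ((cnt M k j ≡ᵇ cnt M i j) ∧ (i <ᵇ k))

rank : ℕ → Mat → ℕ → ℕ → ℕ
rank r M j i = length (filter (λ k → Data.Bool._≟_ (beats M j k i) true) (range1 r))

chosen : {r : ℕ} → Vec ℕ r → Mat → ℕ → ℕ → Bool
chosen {r} la M j i = rank r M j i <ᵇ conj la j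

rightmost1 : Mat → ℕ → ℕ → Maybe ℕ
rightmost1 M i zero    = nothing
rightmost1 M i (suc j) = if M i (suc j) ≡ᵇ 1 then just (suc j) else rightmost1 M i j

moveTo : ℕ → Maybe ℕ → ℕ → ℕ → ℕ
moveTo j nothing  c x = x
moveTo j (just p) c x = if c ≡ᵇ j then 1 else (if c ≡ᵇ p then 0 else x)

step : {r : ℕ} → Vec ℕ r → ℕ → Mat → Mat
step la j M i c =
  if (1 ≤ᵇ i) ∧ chosen la M j i then moveTo j (rightmost1 M i j) c (M i c) else M i c

run : {r : ℕ} → Vec ℕ r → ℕ → Mat → Mat
run la zero    M = M
run la (suc j) M = run la j (step la (suc j) M)

-- canonical (Ryser) matrix A(λ, μ), with s = λ_1
ryser : {r : ℕ} → Vec ℕ r → Vec ℕ r → Mat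
ryser la mu = run la (part la 1) (initMat mu)

-- A*(λ, μ)_{i,j} = A_{i,j} - A_{i+1,j}  (row r+1 is zero)
ryserStar : {r : ℕ} → Vec ℕ r → Vec ℕ r → ℕ → ℕ → ℤ
ryserStar la mu i j = + ryser la mu i j - + ryser la mu (suc i) j

-- Before the step for column j, columns 1..j of the working matrix are left-justified: row i
-- holds κ i ones followed by zeros, with κ weakly decreasing. Moving the last 1 of each chosen
-- row into column j keeps this shape on columns 1..j-1, because rows with more 1's are preferred
-- and ties go south. The same preference shows that a 0 over a 1 in column j (an entry -1 of A*)
-- only occurs between rows of equal length κ, so rows i and i+1 of A then have equally many 1's
-- in columns 1..j, and row i has one more 1 than row i+1 in columns 1..j-1. Scanning leftwards
-- from j-1, the first column where the two rows differ cannot hold a 0 over a 1 (that would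
-- equalise the counts again), so it holds a 1 over a 0: an entry 1 of A*, with zeros in between.
module Submission where

open import Defs
open import Data.Nat using (ℕ; zero; suc; _+_; _∸_; _≤_; _<_; z≤n; s≤s; z<s; _≡ᵇ_; _≤ᵇ_)
open import Data.Nat.Properties
open import Data.Bool as Bool using (true; false; T; if_then_else_; _∧_)
open import Data.Bool.Properties using (T-≡; T-∧; T-∨)
open import Data.Unit using (tt)
open import Data.List using (_∷_; map; upTo; length; [_]; _++_)
open import Data.List.Properties using (map-++; upTo-∷ʳ)
open import Data.Nat.ListAction using (sum)
open import Data.Nat.ListAction.Properties using (sum-++)
open import Data.Vec using (Vec; toList)
open import Data.Vec.Properties using (length-toList)
open import Data.Maybe using (Maybe; just; nothing)
open import Data.Maybe.Relation.Unary.All as All using (All; just; nothing)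
open import Data.Integer using (+_; -[1+_]; _-_)
open import Data.Integer.Properties using (+-inverseʳ)
open import Data.Product using (Σ; _×_; _,_; proj₂)
open import Data.Sum using (_⊎_; inj₁; inj₂)
open import Function using (_∘′_)
open import Function.Bundles using (Equivalence)
open import Data.List.Relation.Binary.Sublist.Propositional using (⊆-refl)
open import Data.List.Relation.Binary.Sublist.Propositional.Properties using (filter⁺; length-mono-≤)
open import Relation.Nullary using (¬_; contradiction; yes; no)
open import Relation.Nullary.Decidable using (T?)
open import Relation.Binary.PropositionalEquality hiding ([_])

open Equivalence using (to; from)

if-≤ : ∀ b {x y n : ℕ} → x ≤ n → y ≤ n → (if b then x else y) ≤ n
if-≤ true  x≤n _   = x≤n
if-≤ false _   y≤n = y≤n

if-T : ∀ {A : Set} {b} {x y : A} → T b → (if b then x else y) ≡ x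
if-T {b = true} _ = refl

if-¬T : ∀ {A : Set} {b} {x y : A} → ¬ T b → (if b then x else y) ≡ y
if-¬T {b = true}  ¬t = contradiction tt ¬t
if-¬T {b = false} _  = refl

if-≡ᵇ-≢ : ∀ {A : Set} {m n} {x y : A} → m ≢ n → (if m ≡ᵇ n then x else y) ≡ y
if-≡ᵇ-≢ {m = m} {n} m≢n = if-¬T (m≢n ∘′ ≡ᵇ⇒≡ m n)

sum-range1-suc : ∀ (f : ℕ → ℕ) n →
  sum (map f (range1 (suc n))) ≡ sum (map f (range1 n)) + f (suc n)
sum-range1-suc f n = begin
  sum (map f (map suc (upTo (suc n))))         ≡⟨ cong (sum ∘′ map f ∘′ map suc) (upTo-∷ʳ n) ⟨
  sum (map f (map suc (upTo n ++ [ n ])))      ≡⟨ cong (sum ∘′ map f) (map-++ suc (upTo n) [ n ]) ⟩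
  sum (map f (range1 n ++ [ suc n ]))          ≡⟨ cong sum (map-++ f (range1 n) [ suc n ]) ⟩
  sum (map f (range1 n) ++ [ f (suc n) ])      ≡⟨ sum-++ (map f (range1 n)) [ f (suc n) ] ⟩
  sum (map f (range1 n)) + (f (suc n) + 0)     ≡⟨ cong₂ _+_ refl (+-identityʳ (f (suc n))) ⟩
  sum (map f (range1 n)) + f (suc n)           ∎
  where open ≡-Reasoning

record LeftJustified (n : ℕ) (f : ℕ → ℕ) (k : ℕ) : Set where
  field
    length≤ : k ≤ n
    ones    : ∀ c → 1 ≤ c → c ≤ k → f c ≡ 1
    zeros   : ∀ c → k < c → c ≤ n → f c ≡ 0

module _ {n : ℕ} {f : ℕ → ℕ} where

  shrink : ∀ {k} → LeftJustified (suc n) f k → k ≤ n → LeftJustified n f k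
  shrink J k≤n = record
    { length≤ = k≤n
    ; ones    = ones
    ; zeros   = λ c k<c c≤n → zeros c k<c (m≤n⇒m≤1+n c≤n) }
    where open LeftJustified J

  shrink-full : LeftJustified (suc n) f (suc n) → LeftJustified n f n
  shrink-full J = record
    { length≤ = ≤-refl
    ; ones    = λ c 1≤c c≤n → ones c 1≤c (m≤n⇒m≤1+n c≤n)
    ; zeros   = λ c n<c c≤n → contradiction c≤n (<⇒≱ n<c) }
    where open LeftJustified J

  last-column : ∀ {k} → LeftJustified (suc n) f k →
    (k ≡ suc n × f (suc n) ≡ 1) ⊎ (k ≤ n × f (suc n) ≡ 0)
  last-column J with m≤n⇒m<n∨m≡n (LeftJustified.length≤ J)
  ... | inj₁ (s≤s k≤n) = inj₂ (k≤n , LeftJustified.zeros J (suc n) (s≤s k≤n) ≤-refl)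
  ... | inj₂ refl      = inj₁ (refl , LeftJustified.ones J (suc n) (s≤s z≤n) ≤-refl)

  last≤length : ∀ {k} → LeftJustified (suc n) f k → f (suc n) ≤ k
  last≤length J with last-column J
  ... | inj₁ (refl , fn≡1) = ≤-trans (≤-reflexive fn≡1) (s≤s z≤n)
  ... | inj₂ (_ , fn≡0)    = ≤-trans (≤-reflexive fn≡0) z≤n

  restrict : ∀ {k} → LeftJustified (suc n) f k → LeftJustified n f (k ∸ f (suc n))
  restrict J with last-column J
  ... | inj₁ (refl , fn≡1) rewrite fn≡1 = shrink-full J
  ... | inj₂ (k≤n , fn≡0) rewrite fn≡0 = shrink J k≤n

LeftJustified-cong : ∀ {n f g k} → (∀ c → f c ≡ g c) → LeftJustified n f k → LeftJustified n g k
LeftJustified-cong f≗g J = record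
  { length≤ = length≤
  ; ones    = λ c 1≤c c≤k → trans (sym (f≗g c)) (ones c 1≤c c≤k)
  ; zeros   = λ c k<c c≤n → trans (sym (f≗g c)) (zeros c k<c c≤n) }
  where open LeftJustified J

sum-leftJustified : ∀ {n f k} → LeftJustified n f k → sum (map f (range1 n)) ≡ k
sum-leftJustified {zero}          J = sym (n≤0⇒n≡0 (LeftJustified.length≤ J))
sum-leftJustified {suc n} {f} {k} J = begin
  sum (map f (range1 (suc n)))       ≡⟨ sum-range1-suc f n ⟩
  sum (map f (range1 n)) + f (suc n) ≡⟨ cong₂ _+_ (sum-leftJustified (restrict J)) refl ⟩
  k ∸ f (suc n) + f (suc n)          ≡⟨ m∸n+n≡m (last≤length J) ⟩
  k                                  ∎
  where open ≡-Reasoning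

justNonzero : ℕ → Maybe ℕ
justNonzero zero    = nothing
justNonzero (suc k) = just (suc k)

rightmost1-≤ : ∀ M i n → All (_≤ n) (rightmost1 M i n)
rightmost1-≤ M i zero = nothing
rightmost1-≤ M i (suc n) with M i (suc n) ≡ᵇ 1
... | true  = just ≤-refl
... | false = All.map m≤n⇒m≤1+n (rightmost1-≤ M i n)

rightmost1-leftJustified : ∀ M i {n k} → LeftJustified n (M i) k →
  rightmost1 M i n ≡ justNonzero k
rightmost1-leftJustified M i {zero} J rewrite n≤0⇒n≡0 (LeftJustified.length≤ J) = refl
rightmost1-leftJustified M i {suc n} J with last-column J
... | inj₁ (refl , Mn≡1) rewrite Mn≡1 = refl
... | inj₂ (k≤n , Mn≡0) rewrite Mn≡0 = rightmost1-leftJustified M i (shrink J k≤n)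

moveTo-target : ∀ j p x → moveTo j (just p) j x ≡ 1
moveTo-target j p x = if-T (≡⇒≡ᵇ j j refl)

moveTo-source : ∀ {j c} x → c ≢ j → moveTo j (just c) c x ≡ 0
moveTo-source {c = c} x c≢j = trans (if-≡ᵇ-≢ c≢j) (if-T (≡⇒≡ᵇ c c refl))

moveTo-other : ∀ {j p c} x → c ≢ j → c ≢ p → moveTo j (just p) c x ≡ x
moveTo-other x c≢j c≢p = trans (if-≡ᵇ-≢ c≢j) (if-≡ᵇ-≢ c≢p)

moveTo-above : ∀ {j m c} x → j < c → All (_≤ j) m → moveTo j m c x ≡ x
moveTo-above x j<c nothing      = refl
moveTo-above x j<c (just p≤j) = moveTo-other x (>⇒≢ j<c) (>⇒≢ (≤-<-trans p≤j j<c))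

moveTo-leftJustified : ∀ {n f k} → LeftJustified (suc n) f (suc k) →
  LeftJustified n (λ c → moveTo (suc n) (just (suc k)) c (f c)) k
moveTo-leftJustified {n} {f} {k} J = record
  { length≤ = ≤-pred length≤
  ; ones    = λ c 1≤c c≤k →
      trans (moveTo-other (f c) (<⇒≢ (s≤s (≤-trans c≤k (≤-pred length≤)))) (<⇒≢ (s≤s c≤k)))
            (ones c 1≤c (m≤n⇒m≤1+n c≤k))
  ; zeros   = zeros′ }
  where
  open LeftJustified J
  zeros′ : ∀ c → k < c → c ≤ n → moveTo (suc n) (just (suc k)) c (f c) ≡ 0
  zeros′ c k<c c≤n with m≤n⇒m<n∨m≡n k<c
  ... | inj₂ refl     = moveTo-source (f c) (<⇒≢ (s≤s c≤n))
  ... | inj₁ suc-k<c = trans (moveTo-other (f c) (<⇒≢ (s≤s c≤n)) (>⇒≢ suc-k<c))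
                             (zeros c suc-k<c (m≤n⇒m≤1+n c≤n))

Binary : Mat → Set
Binary M = ∀ i c → M i c ≤ 1

initMat-binary : ∀ {r} (mu : Vec ℕ r) → Binary (initMat mu)
initMat-binary mu i c = if-≤ _ ≤-refl z≤n

step-binary : ∀ {r} (la : Vec ℕ r) j {M} → Binary M → Binary (step la j M)
step-binary la j {M} B i c = if-≤ _ (moveTo-≤1 (rightmost1 M i j)) (B i c)
  where
  moveTo-≤1 : ∀ m → moveTo j m c (M i c) ≤ 1
  moveTo-≤1 nothing  = B i c
  moveTo-≤1 (just p) = if-≤ (c ≡ᵇ j) ≤-refl (if-≤ (c ≡ᵇ p) z≤n (B i c))

run-binary : ∀ {r} (la : Vec ℕ r) n {M} → Binary M → Binary (run la n M)
run-binary la zero    B = B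
run-binary la (suc n) B = run-binary la n (step-binary la (suc n) B)

step-above : ∀ {r} (la : Vec ℕ r) j M i {c} → j < c → step la j M i c ≡ M i c
step-above la j M i {c} j<c with (1 ≤ᵇ i) ∧ chosen la M j i
... | true  = moveTo-above (M i c) j<c (rightmost1-≤ M i j)
... | false = refl

run-above : ∀ {r} (la : Vec ℕ r) n M i {c} → n < c → run la n M i c ≡ M i c
run-above la zero    M i n<c = refl
run-above la (suc n) M i n<c =
  trans (run-above la n (step la (suc n) M) i (<-trans (n<1+n n) n<c)) (step-above la (suc n) M i n<c)

Beats : Mat → ℕ → ℕ → ℕ → Set
Beats M j k i = cnt M i j < cnt M k j ⊎ (cnt M k j ≡ cnt M i j × i < k)

beats⇒Beats : ∀ M j k i → beats M j k i ≡ true → Beats M j k i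
beats⇒Beats M j k i b with to T-∨ (from T-≡ b)
... | inj₁ lt = inj₁ (<ᵇ⇒< _ _ lt)
... | inj₂ tie with to T-∧ tie
...   | eq , lt = inj₂ (≡ᵇ⇒≡ _ _ eq , <ᵇ⇒< _ _ lt)

Beats⇒beats : ∀ M j k i → Beats M j k i → beats M j k i ≡ true
Beats⇒beats M j k i (inj₁ lt)        = to T-≡ (from T-∨ (inj₁ (<⇒<ᵇ lt)))
Beats⇒beats M j k i (inj₂ (eq , lt)) =
  to T-≡ (from T-∨ (inj₂ (from T-∧ (≡⇒≡ᵇ _ _ eq , <⇒<ᵇ lt))))

rank-mono : ∀ r M j {a b} → (∀ k → Beats M j k a → Beats M j k b) → rank r M j a ≤ rank r M j b
rank-mono r M j {a} {b} a⇒b = length-mono-≤ (filter⁺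
  (λ k → beats M j k a Bool.≟ true) (λ k → beats M j k b Bool.≟ true)
  (λ { {k} refl → Beats⇒beats M j k b ∘′ a⇒b k ∘′ beats⇒Beats M j k a })
  (⊆-refl {x = range1 r}))

chosen-antitone : ∀ {r} (la : Vec ℕ r) M j {a b} → rank r M j a ≤ rank r M j b →
  T (chosen la M j b) → T (chosen la M j a)
chosen-antitone {r} la M j {b = b} a≤b b-chosen =
  <⇒<ᵇ (≤-<-trans a≤b (<ᵇ⇒< (rank r M j b) (conj la j) b-chosen))

chosen-moreOnes : ∀ {r} (la : Vec ℕ r) M j {a b} → cnt M b j < cnt M a j →
  T (chosen la M j b) → T (chosen la M j a)
chosen-moreOnes {r} la M j {a} {b} b<a = chosen-antitone la M j (rank-mono r M j beats-b)
  where
  beats-b : ∀ k → Beats M j k a → Beats M j k b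
  beats-b k (inj₁ a<k)       = inj₁ (<-trans b<a a<k)
  beats-b k (inj₂ (k≡a , _)) = inj₁ (subst (cnt M b j <_) (sym k≡a) b<a)

chosen-southAtTie : ∀ {r} (la : Vec ℕ r) M j {a b} → a < b → cnt M a j ≡ cnt M b j →
  T (chosen la M j a) → T (chosen la M j b)
chosen-southAtTie {r} la M j {a} {b} a<b a≡b = chosen-antitone la M j (rank-mono r M j beats-a)
  where
  beats-a : ∀ k → Beats M j k b → Beats M j k a
  beats-a k (inj₁ b<k)          = inj₁ (subst (_< cnt M k j) (sym a≡b) b<k)
  beats-a k (inj₂ (k≡b , b<k)) = inj₂ (trans k≡b (sym a≡b) , <-trans a<b b<k)

≤-fromBit : ∀ {x y} → x ≤ 1 → (x ≡ 1 → y ≡ 1) → x ≤ y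
≤-fromBit z≤n       _   = z≤n
≤-fromBit (s≤s z≤n) x⇒y = ≤-reflexive (sym (x⇒y refl))

record Justified (n : ℕ) (M : Mat) (κ : ℕ → ℕ) : Set where
  field
    rows       : ∀ i → LeftJustified n (M i) (κ i)
    decreasing : ∀ i → 1 ≤ i → κ (suc i) ≤ κ i

step-unmoved : ∀ {r} (la : Vec ℕ r) j M i → ¬ T ((1 ≤ᵇ i) ∧ chosen la M j i) →
  ∀ c → step la j M i c ≡ M i c
step-unmoved la j M i ¬moves c = if-¬T ¬moves

step-moved : ∀ {r} (la : Vec ℕ r) j M i → T ((1 ≤ᵇ i) ∧ chosen la M j i) →
  ∀ c → step la j M i c ≡ moveTo j (rightmost1 M i j) c (M i c)
step-moved la j M i moves c = if-T moves

module StepAt {r} (la : Vec ℕ r) (n : ℕ) {M : Mat} {κ : ℕ → ℕ} (J : Justified (suc n) M κ) where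

  open Justified J

  j : ℕ
  j = suc n

  M′ : Mat
  M′ = step la j M

  e : ℕ → ℕ
  e i = M′ i j

  data RowStep (i : ℕ) : Set where
    stays  : (∀ c → M′ i c ≡ M i c) → (1 ≤ i → 0 < κ i → ¬ T (chosen la M j i)) → RowStep i
    shifts : ∀ {k} → κ i ≡ suc k → T (chosen la M j i) →
             (∀ c → M′ i c ≡ moveTo j (just (suc k)) c (M i c)) → RowStep i

  moveTo-rightmost : ∀ {i k} → κ i ≡ k →
    ∀ c → moveTo j (rightmost1 M i j) c (M i c) ≡ moveTo j (justNonzero k) c (M i c)
  moveTo-rightmost {i} κi c =
    cong (λ m → moveTo j m c (M i c)) (trans (rightmost1-leftJustified M i (rows i)) (cong justNonzero κi))

  rowStep : ∀ i → RowStep i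
  rowStep i with T? ((1 ≤ᵇ i) ∧ chosen la M j i) | κ i in κi
  ... | no ¬moves | _     = stays (step-unmoved la j M i ¬moves)
                                  (λ 1≤i _ ch → ¬moves (from T-∧ (≤⇒≤ᵇ 1≤i , ch)))
  ... | yes moves | zero  = stays (λ c → trans (step-moved la j M i moves c) (moveTo-rightmost κi c))
                                  (λ _ 0<κ → contradiction κi (n>0⇒n≢0 0<κ))
  ... | yes moves | suc k = shifts κi (proj₂ (to T-∧ moves))
                                  (λ c → trans (step-moved la j M i moves c) (moveTo-rightmost κi c))

  shifted-entry : ∀ {i k} → (∀ c → M′ i c ≡ moveTo j (just (suc k)) c (M i c)) → e i ≡ 1
  shifted-entry {i} {k} st = trans (st j) (moveTo-target j (suc k) (M i j))

  cnt-rows : ∀ i → cnt M i j ≡ κ i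
  cnt-rows i = sum-leftJustified (rows i)

  FillsColumn : ℕ → Set
  FillsColumn i = κ i ≡ j ⊎ (0 < κ i × T (chosen la M j i))

  entry≤1 : ∀ i → e i ≤ 1
  entry≤1 i with rowStep i
  ... | shifts _ _ st = ≤-reflexive (shifted-entry st)
  ... | stays st _ with last-column (rows i)
  ...   | inj₁ (_ , Mj≡1) = ≤-reflexive (trans (st j) Mj≡1)
  ...   | inj₂ (_ , Mj≡0) = ≤-trans (≤-reflexive (trans (st j) Mj≡0)) z≤n

  entry≡1⇒fills : ∀ i → e i ≡ 1 → FillsColumn i
  entry≡1⇒fills i e≡1 with rowStep i
  ... | shifts κi ch _ = inj₂ (subst (0 <_) (sym κi) z<s , ch)
  ... | stays st _ with last-column (rows i)
  ...   | inj₁ (κi , _)   = inj₁ κi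
  ...   | inj₂ (_ , Mj≡0) = contradiction (trans (sym Mj≡0) (trans (sym (st j)) e≡1)) λ ()

  fills⇒entry≡1 : ∀ i → 1 ≤ i → FillsColumn i → e i ≡ 1
  fills⇒entry≡1 i 1≤i fills with rowStep i
  ... | shifts _ _ st = shifted-entry st
  ... | stays st unchosen with fills
  ...   | inj₁ κi          = trans (st j) (LeftJustified.ones (rows i) j z<s (≤-reflexive (sym κi)))
  ...   | inj₂ (0<κ , ch) = contradiction ch (unchosen 1≤i 0<κ)

  fills⇒positive : ∀ i → FillsColumn i → 0 < κ i
  fills⇒positive i (inj₁ κi)        = subst (0 <_) (sym κi) z<s
  fills⇒positive i (inj₂ (0<κ , _)) = 0<κ

  fills-southAtTie : ∀ i → κ (suc i) ≡ κ i → FillsColumn i → FillsColumn (suc i)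
  fills-southAtTie i tie (inj₁ κi)          = inj₁ (trans tie κi)
  fills-southAtTie i tie (inj₂ (0<κ , ch)) =
    inj₂ (subst (0 <_) (sym tie) 0<κ ,
          chosen-southAtTie la M j (n<1+n i) (trans (cnt-rows i) (trans (sym tie) (sym (cnt-rows (suc i))))) ch)

  fills-northAtDrop : ∀ i → κ (suc i) < κ i → FillsColumn (suc i) → FillsColumn i
  fills-northAtDrop i drop (inj₁ κs) =
    contradiction (LeftJustified.length≤ (rows i)) (<⇒≱ (subst (_< κ i) κs drop))
  fills-northAtDrop i drop (inj₂ (0<κ , ch)) =
    inj₂ (<-trans 0<κ drop ,
          chosen-moreOnes la M j (subst₂ _<_ (sym (cnt-rows (suc i))) (sym (cnt-rows i)) drop) ch)

  entry-southAtTie : ∀ i → κ (suc i) ≡ κ i → e i ≤ e (suc i)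
  entry-southAtTie i tie = ≤-fromBit (entry≤1 i)
    (fills⇒entry≡1 (suc i) z<s ∘′ fills-southAtTie i tie ∘′ entry≡1⇒fills i)

  entry-northAtDrop : ∀ i → 1 ≤ i → κ (suc i) < κ i → e (suc i) ≤ e i
  entry-northAtDrop i 1≤i drop = ≤-fromBit (entry≤1 (suc i))
    (fills⇒entry≡1 i 1≤i ∘′ fills-northAtDrop i drop ∘′ entry≡1⇒fills (suc i))

  entry≤length : ∀ i → e i ≤ κ i
  entry≤length i with e i in e≡ | entry≤1 i
  ... | zero        | _      = z≤n
  ... | suc zero    | _      = fills⇒positive i (entry≡1⇒fills i e≡)
  ... | suc (suc _) | s≤s ()

  κ′ : ℕ → ℕ
  κ′ i = κ i ∸ e i

  rows′ : ∀ i → LeftJustified n (M′ i) (κ′ i)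
  rows′ i with rowStep i
  ... | stays st _ =
    subst (LeftJustified n (M′ i)) (cong (κ i ∸_) (sym (st j)))
      (LeftJustified-cong (λ c → sym (st c)) (restrict (rows i)))
  ... | shifts κi _ st =
    subst (LeftJustified n (M′ i)) (sym (cong₂ _∸_ κi (shifted-entry st)))
      (LeftJustified-cong (λ c → sym (st c))
        (moveTo-leftJustified (subst (LeftJustified j (M i)) κi (rows i))))

  decreasing′ : ∀ i → 1 ≤ i → κ′ (suc i) ≤ κ′ i
  decreasing′ i 1≤i with m≤n⇒m<n∨m≡n (decreasing i 1≤i)
  ... | inj₂ tie rewrite tie = ∸-monoʳ-≤ (κ i) (entry-southAtTie i tie)
  ... | inj₁ drop = begin
    κ (suc i) ∸ e (suc i) ≤⟨ m∸n≤m (κ (suc i)) (e (suc i)) ⟩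
    κ (suc i)             ≤⟨ <⇒≤pred drop ⟩
    κ i ∸ 1               ≤⟨ ∸-monoʳ-≤ (κ i) (entry≤1 i) ⟩
    κ i ∸ e i             ∎
    where open ≤-Reasoning

  justified′ : Justified n M′ κ′
  justified′ = record { rows = rows′ ; decreasing = decreasing′ }

  zeroOverOne⇒sameLength : ∀ i → 1 ≤ i → e i ≡ 0 → e (suc i) ≡ 1 → κ i ≡ κ (suc i)
  zeroOverOne⇒sameLength i 1≤i e≡0 e′≡1 with m≤n⇒m<n∨m≡n (decreasing i 1≤i)
  ... | inj₂ tie  = sym tie
  ... | inj₁ drop = contradiction (subst₂ _≤_ e′≡1 e≡0 (entry-northAtDrop i 1≤i drop)) λ ()

run-cnt : ∀ {r} (la : Vec ℕ r) n {M κ} → Justified n M κ → ∀ i → cnt (run la n M) i n ≡ κ i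
run-cnt la zero    J i = sym (n≤0⇒n≡0 (LeftJustified.length≤ (Justified.rows J i)))
run-cnt la (suc n) {M} {κ} J i = begin
  cnt A i (suc n)        ≡⟨ sum-range1-suc (A i) n ⟩
  cnt A i n + A i (suc n) ≡⟨ cong₂ _+_ (run-cnt la n justified′ i) (run-above la n M′ i ≤-refl) ⟩
  κ i ∸ e i + e i        ≡⟨ m∸n+n≡m (entry≤length i) ⟩
  κ i                    ∎
  where
  open StepAt la n J
  A = run la n M′
  open ≡-Reasoning

TiesAtMinusOnes : Mat → ℕ → Set
TiesAtMinusOnes A n = ∀ i → 1 ≤ i → ∀ c → 1 ≤ c → c ≤ n → A i c ≡ 0 → A (suc i) c ≡ 1 →
  cnt A i c ≡ cnt A (suc i) c

run-ties : ∀ {r} (la : Vec ℕ r) n {M κ} → Justified n M κ → TiesAtMinusOnes (run la n M) n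
run-ties la zero    J i _ c 1≤c c≤0 = contradiction (≤-trans 1≤c c≤0) λ ()
run-ties la (suc n) {M} {κ} J i 1≤i c 1≤c c≤n A≡0 A′≡1 with m≤n⇒m<n∨m≡n c≤n
... | inj₁ c<n = run-ties la n justified′ i 1≤i c 1≤c (≤-pred c<n) A≡0 A′≡1
  where open StepAt la n J
... | inj₂ refl = begin
  cnt A i (suc n)       ≡⟨ run-cnt la (suc n) J i ⟩
  κ i                   ≡⟨ zeroOverOne⇒sameLength i 1≤i (trans (sym (run-above la n M′ i ≤-refl)) A≡0)
                             (trans (sym (run-above la n M′ (suc i) ≤-refl)) A′≡1) ⟩
  κ (suc i)             ≡⟨ run-cnt la (suc n) J (suc i) ⟨
  cnt A (suc i) (suc n) ∎
  where
  open StepAt la n J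
  A = run la n M′
  open ≡-Reasoning

bits-differ : ∀ {x y} → x ≤ 1 → y ≤ 1 → x ≢ y → (x ≡ 1 × y ≡ 0) ⊎ (x ≡ 0 × y ≡ 1)
bits-differ z≤n       z≤n       x≢y = contradiction refl x≢y
bits-differ z≤n       (s≤s z≤n) _   = inj₂ (refl , refl)
bits-differ (s≤s z≤n) z≤n       _   = inj₁ (refl , refl)
bits-differ (s≤s z≤n) (s≤s z≤n) x≢y = contradiction refl x≢y

LastDifferenceOneOverZero : Mat → ℕ → ℕ → Set
LastDifferenceOneOverZero A i n = Σ ℕ λ k → (1 ≤ k × k ≤ n) × (A i k ≡ 1 × A (suc i) k ≡ 0)
  × (∀ m → k < m → m ≤ n → A i m ≡ A (suc i) m)

module _ (A : Mat) (i : ℕ) where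

  excess-shrink : ∀ {n} → A i (suc n) ≡ A (suc i) (suc n) →
    cnt A i (suc n) ≡ suc (cnt A (suc i) (suc n)) → cnt A i n ≡ suc (cnt A (suc i) n)
  excess-shrink {n} same excess = +-cancelʳ-≡ (A i (suc n)) _ _ (begin
    cnt A i n + A i (suc n)             ≡⟨ sum-range1-suc (A i) n ⟨
    cnt A i (suc n)                     ≡⟨ excess ⟩
    suc (cnt A (suc i) (suc n))         ≡⟨ cong suc (sum-range1-suc (A (suc i)) n) ⟩
    suc (cnt A (suc i) n + A (suc i) (suc n)) ≡⟨ cong (λ x → suc (cnt A (suc i) n + x)) same ⟨
    suc (cnt A (suc i) n) + A i (suc n) ∎)
    where open ≡-Reasoning

  tie⇒excessBefore : ∀ {n} → A i (suc n) ≡ 0 → A (suc i) (suc n) ≡ 1 →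
    cnt A i (suc n) ≡ cnt A (suc i) (suc n) → cnt A i n ≡ suc (cnt A (suc i) n)
  tie⇒excessBefore {n} a≡0 b≡1 tie = begin
    cnt A i n                         ≡⟨ +-identityʳ (cnt A i n) ⟨
    cnt A i n + 0                     ≡⟨ cong₂ _+_ refl a≡0 ⟨
    cnt A i n + A i (suc n)           ≡⟨ sum-range1-suc (A i) n ⟨
    cnt A i (suc n)                   ≡⟨ tie ⟩
    cnt A (suc i) (suc n)             ≡⟨ sum-range1-suc (A (suc i)) n ⟩
    cnt A (suc i) n + A (suc i) (suc n) ≡⟨ cong₂ _+_ refl b≡1 ⟩
    cnt A (suc i) n + 1               ≡⟨ +-comm (cnt A (suc i) n) 1 ⟩
    suc (cnt A (suc i) n)             ∎
    where open ≡-Reasoning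

  lastDifference-extend : ∀ {n} → A i (suc n) ≡ A (suc i) (suc n) →
    LastDifferenceOneOverZero A i n → LastDifferenceOneOverZero A i (suc n)
  lastDifference-extend {n} same (k , (1≤k , k≤n) , entries , after) =
    k , (1≤k , m≤n⇒m≤1+n k≤n) , entries , after′
    where
    after′ : ∀ m → k < m → m ≤ suc n → A i m ≡ A (suc i) m
    after′ m k<m m≤n with m≤n⇒m<n∨m≡n m≤n
    ... | inj₁ m<n  = after m k<m (≤-pred m<n)
    ... | inj₂ refl = same

  excess⇒lastDifferenceOneOverZero : Binary A → ∀ n →
    (∀ c → 1 ≤ c → c ≤ n → A i c ≡ 0 → A (suc i) c ≡ 1 → cnt A i c ≡ cnt A (suc i) c) →
    cnt A i n ≡ suc (cnt A (suc i) n) → LastDifferenceOneOverZero A i n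
  excess⇒lastDifferenceOneOverZero B zero    ties ()
  excess⇒lastDifferenceOneOverZero B (suc n) ties excess with A i (suc n) ≟ A (suc i) (suc n)
  ... | yes same = lastDifference-extend same (excess⇒lastDifferenceOneOverZero B n
                     (λ c 1≤c c≤n → ties c 1≤c (m≤n⇒m≤1+n c≤n)) (excess-shrink same excess))
  ... | no differ with bits-differ (B i (suc n)) (B (suc i) (suc n)) differ
  ...   | inj₁ (a≡1 , b≡0) =
    suc n , (z<s , ≤-refl) , (a≡1 , b≡0) , λ m n<m m≤n → contradiction m≤n (<⇒≱ n<m)
  ...   | inj₂ (a≡0 , b≡1) =
    contradiction (trans (sym (ties (suc n) z<s ≤-refl a≡0 b≡1)) excess) λ eq → <-irrefl eq (n<1+n _)

at-positive : ∀ xs i → 0 < at xs i → 1 ≤ i × i ≤ length xs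
at-positive (x ∷ xs) (suc zero)    _   = s≤s z≤n , s≤s z≤n
at-positive (x ∷ xs) (suc (suc i)) pos = s≤s z≤n , s≤s (proj₂ (at-positive xs (suc i) pos))

part-positive : ∀ {r} (v : Vec ℕ r) i → 0 < part v i → 1 ≤ i × i ≤ r
part-positive v i pos with at-positive (toList v) i pos
... | 1≤i , i≤len = 1≤i , subst (i ≤_) (length-toList v) i≤len

part-outside : ∀ {r} (v : Vec ℕ r) i → ¬ (1 ≤ i × i ≤ r) → part v i ≡ 0
part-outside v i outside with part v i in pi
... | zero  = refl
... | suc _ = contradiction (part-positive v i (subst (0 <_) (sym pi) z<s)) outside

module _ {r} (v : Vec ℕ r) (P : IsPartition v) where

  partition-decreasing : ∀ i → 1 ≤ i → part v (suc i) ≤ part v i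
  partition-decreasing i 1≤i with suc i ≤? r
  ... | yes i<r = P i 1≤i i<r
  ... | no  i≮r = ≤-trans (≤-reflexive (part-outside v (suc i) (i≮r ∘′ proj₂))) z≤n

  partition-≤-first : ∀ i → part v i ≤ part v 1
  partition-≤-first zero          = ≤-trans (≤-reflexive (part-outside v 0 λ ())) z≤n
  partition-≤-first (suc zero)    = ≤-refl
  partition-≤-first (suc (suc i)) = ≤-trans (partition-decreasing (suc i) z<s) (partition-≤-first (suc i))

initMat-justified : ∀ {r} (la mu : Vec ℕ r) → Kostka r la mu → Justified (part la 1) (initMat mu) (part mu)
initMat-justified {r} la mu (_ , μ-partition , _ , dominance) = record
  { rows = λ i → record
      { length≤ = ≤-trans (partition-≤-first mu μ-partition i) μ₁≤λ₁
      ; ones    = λ c 1≤c c≤μ → if-T (inRange i c 1≤c c≤μ)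
      ; zeros   = λ c μ<c _ →
          if-¬T (<⇒≱ μ<c ∘′ ≤ᵇ⇒≤ c (part mu i) ∘′ lastConjunct (1 ≤ᵇ i) (i ≤ᵇ r) (1 ≤ᵇ c)) }
  ; decreasing = partition-decreasing mu μ-partition }
  where
  μ₁≤λ₁ : part mu 1 ≤ part la 1
  μ₁≤λ₁ with 1 ≤? r
  ... | yes 1≤r = subst₂ _≤_ (+-identityʳ (part mu 1)) (+-identityʳ (part la 1)) (dominance 1 1≤r)
  ... | no  1≰r = ≤-trans (≤-reflexive (part-outside mu 1 (1≰r ∘′ proj₂))) z≤n
  inRange : ∀ i c → 1 ≤ c → c ≤ part mu i →
    T ((1 ≤ᵇ i) ∧ (i ≤ᵇ r) ∧ (1 ≤ᵇ c) ∧ (c ≤ᵇ part mu i))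
  inRange i c 1≤c c≤μ with part-positive mu i (≤-trans 1≤c c≤μ)
  ... | 1≤i , i≤r =
    from T-∧ (≤⇒≤ᵇ 1≤i , from T-∧ (≤⇒≤ᵇ i≤r , from T-∧ (≤⇒≤ᵇ 1≤c , ≤⇒≤ᵇ c≤μ)))
  lastConjunct : ∀ a b c {d} → T (a ∧ b ∧ c ∧ d) → T d
  lastConjunct true true true t = t

minusOne-entries : ∀ {x y} → x ≤ 1 → y ≤ 1 → + x - + y ≡ -[1+ 0 ] → x ≡ 0 × y ≡ 1
minusOne-entries z≤n (s≤s z≤n) _ = refl , refl
minusOne-entries z≤n z≤n ()
minusOne-entries (s≤s z≤n) z≤n ()
minusOne-entries (s≤s z≤n) (s≤s z≤n) ()

lemma2p18 : (r : ℕ) (la mu : Vec ℕ r) → Kostka r la mu →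
    (i j : ℕ) → 1 ≤ i → i ≤ r → 1 ≤ j → j ≤ part la 1 →
    ryserStar la mu i j ≡ -[1+ 0 ] →
    Σ ℕ (λ k → (1 ≤ k × k < j) × (ryserStar la mu i k ≡ + 1)
      × ((m : ℕ) → k < m → m < j → ryserStar la mu i m ≡ + 0))
lemma2p18 r la mu K i zero    _   _ () _ _
lemma2p18 r la mu K i (suc n) 1≤i _ _ j≤s star≡-1 =
  conclude (excess⇒lastDifferenceOneOverZero A i binary n
             (λ c 1≤c c≤n → ties c 1≤c (≤-trans (m≤n⇒m≤1+n c≤n) j≤s)) excess)
  where
  A : Mat
  A = ryser la mu
  binary : Binary A
  binary = run-binary la (part la 1) (initMat-binary mu)
  ties : ∀ c → 1 ≤ c → c ≤ part la 1 → A i c ≡ 0 → A (suc i) c ≡ 1 →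
    cnt A i c ≡ cnt A (suc i) c
  ties = run-ties la (part la 1) (initMat-justified la mu K) i 1≤i
  excess : cnt A i n ≡ suc (cnt A (suc i) n)
  excess with minusOne-entries (binary i (suc n)) (binary (suc i) (suc n)) star≡-1
  ... | A≡0 , A′≡1 = tie⇒excessBefore A i A≡0 A′≡1 (ties (suc n) z<s j≤s A≡0 A′≡1)
  conclude : LastDifferenceOneOverZero A i n →
    Σ ℕ (λ k → (1 ≤ k × k < suc n) × (ryserStar la mu i k ≡ + 1)
      × ((m : ℕ) → k < m → m < suc n → ryserStar la mu i m ≡ + 0))
  conclude (k , (1≤k , k≤n) , (Ak≡1 , A′k≡0) , after) =
    k , (1≤k , s≤s k≤n) , cong₂ (λ x y → + x - + y) Ak≡1 A′k≡0 ,
    λ m k<m m≤n → trans (cong (λ y → + A i m - + y) (sym (after m k<m (≤-pred m≤n))))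
                        (+-inverseʳ (+ A i m))
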